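{- Let $t$ be a positive integer and let $M$ be a $t$-spike of order $r$. Then $r(M)=r^*(M)=r$.
   Context: A matroid $M$ is a $t$-spike of order $r$ (with $r\ge t$) if there is a partition $(A_1,\dots,A_r)$ of $E(M)$ into 2-element sets such that for every $t$-element $J\subseteq\{1,\dots,r\}$, the set $\bigcup_{j\in J}A_j$ is both a circuit and a cocircuit of $M$. Here $r(M)$ and $r^*(M)$ denote the rank of $M$ and of its dual. -}

module Defs where

open import Data.Nat using (ℕ; zero; suc; _<_; _≤_)
open import Data.Fin using (Fin; zero; suc)
open import Data.Fin.Subset
open import Data.Vec using (_∷_; [])
open import Data.Product using (Σ; ∃; _×_; _,_)
open import Relation.Binary.PropositionalEquality using (_≡_; _≢_)
open import Relation.Nullary using (¬_)

record Matroid (n : ℕ) : Set₁ where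
  field
    Indep     : Subset n → Set
    indep-⊥   : Indep ⊥
    indep-⊆   : ∀ {X Y} → Y ⊆ X → Indep X → Indep Y
    augment   : ∀ {X Y} → Indep X → Indep Y → ∣ X ∣ < ∣ Y ∣ →
                Σ (Fin n) λ e → e ∈ Y × e ∉ X × Indep (X ∪ ⁅ e ⁆)
open Matroid public

module _ {n : ℕ} (M : Matroid n) where

  Basis : Subset n → Set
  Basis B = Indep M B × (∀ X → B ⊆ X → Indep M X → X ≡ B)

  Circuit : Subset n → Set
  Circuit C = ¬ Indep M C × (∀ Y → Y ⊂ C → Indep M Y)

  -- independent sets of the dual matroid M*: sets disjoint from some basis of M
  CoIndep : Subset n → Set
  CoIndep X = ∃ λ B → Basis B × Empty (X ∩ B)

  Cocircuit : Subset n → Set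
  Cocircuit C = ¬ CoIndep C × (∀ Y → Y ⊂ C → CoIndep Y)

  HasRank : ℕ → Set
  HasRank k = (∃ λ X → Indep M X × ∣ X ∣ ≡ k) × (∀ X → Indep M X → ∣ X ∣ ≤ k)

  HasCorank : ℕ → Set
  HasCorank k = (∃ λ X → CoIndep X × ∣ X ∣ ≡ k) × (∀ X → CoIndep X → ∣ X ∣ ≤ k)

⋃[_]_ : ∀ {n r} → (Fin r → Subset n) → Subset r → Subset n
⋃[_]_ {r = zero}  A []             = ⊥
⋃[_]_ {r = suc r} A (inside  ∷ J) = A zero ∪ (⋃[ (λ j → A (suc j)) ] J)
⋃[_]_ {r = suc r} A (outside ∷ J) = ⋃[ (λ j → A (suc j)) ] J

PairPartition : ∀ {n r} → (Fin r → Subset n) → Set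
PairPartition {n} {r} A =
  (∀ i → ∣ A i ∣ ≡ 2) × (∀ i j → i ≢ j → Empty (A i ∩ A j)) × (⋃[ A ] ⊤ ≡ ⊤)

IsSpikeVia : ∀ {n} → Matroid n → (t r : ℕ) → (Fin r → Subset n) → Set
IsSpikeVia M t r A =
  t ≤ r × PairPartition A ×
  (∀ (J : Subset r) → ∣ J ∣ ≡ t → Circuit M (⋃[ A ] J) × Cocircuit M (⋃[ A ] J))

IsSpike : ∀ {n} → Matroid n → (t r : ℕ) → Set
IsSpike {n} M t r = Σ (Fin r → Subset n) λ A → IsSpikeVia M t r A

module Submission where

-- Write t = suc t′.  The argument is a counting argument on the blocks
-- A_1, …, A_r of the spike, using only two facts about a union ⋃K of t
-- blocks: as a circuit it keeps every independent set from containing all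
-- of it, and as a cocircuit it cannot be avoided by a basis.
--
--   * independent-bound: an independent set inside the union of a set P of
--     blocks has at most |P| + t′ elements.  Removing a block k ∈ P costs at
--     most one element, by exchanging against the circuit ⋃K for a t-set
--     K ∋ k of blocks in P (circuit-extension).
--   * rank-bound: a basis B avoids D₀ - a₀ for the cocircuit D₀ = ⋃J₀ of a
--     t-set J₀, so |B| ≤ 1 + (r - t) + t′ = r.
--   * extension: dually, an independent set inside the union of U gains one
--     element from every block outside U except t′ of them, because every
--     such t-set of blocks is a cocircuit (cocircuit-extension).  Starting
--     from the independent set D₀ - a₀ of size 2t - 1 this reaches size r.
--   * corank-of-rank: for any matroid r*(M) = |E| - r(M), and |E| = 2r.

open import Defs
open import Data.Nat using (ℕ; zero; suc; _+_; _≤_; _<_; z≤n; s≤s; s≤s⁻¹; _≤?_)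
open import Data.Nat.Properties
  using (≤-trans; ≤-reflexive; ≤-antisym; <⇒≱; ≰⇒>; m≤m+n; +-suc; +-comm; +-assoc;
         +-monoˡ-≤; +-monoʳ-≤; +-mono-≤; +-cancelʳ-≡; +-cancelˡ-≤; +-cancelʳ-≤;
         m∸n+n≡m; suc-injective; module ≤-Reasoning)
open import Data.Fin using (Fin; zero; suc; _≟_)
open import Data.Fin.Properties using () renaming (suc-injective to Fin-suc-injective)
open import Data.Fin.Subset
open import Data.Fin.Subset.Properties
open import Data.Vec using (_∷_; []; here; there)
open import Data.Product using (∃; _×_; _,_; proj₁; proj₂)
open import Data.Sum using (inj₁; inj₂)
open import Data.Empty using (⊥-elim)
open import Function using (_∘_)
open import Relation.Binary.PropositionalEquality
open import Relation.Nullary using (yes; no)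

card-∪-disjoint : ∀ {n} (p q : Subset n) → Empty (p ∩ q) → ∣ p ∪ q ∣ ≡ ∣ p ∣ + ∣ q ∣
card-∪-disjoint []            []            _ = refl
card-∪-disjoint (inside ∷ p)  (inside ∷ q)  e = ⊥-elim (e (zero , here))
card-∪-disjoint (inside ∷ p)  (outside ∷ q) e = cong suc (card-∪-disjoint p q (drop-∷-Empty e))
card-∪-disjoint (outside ∷ p) (inside ∷ q)  e =
  trans (cong suc (card-∪-disjoint p q (drop-∷-Empty e))) (sym (+-suc ∣ p ∣ ∣ q ∣))
card-∪-disjoint (outside ∷ p) (outside ∷ q) e = card-∪-disjoint p q (drop-∷-Empty e)

card-insert : ∀ {n} (p : Subset n) {x} → x ∉ p → ∣ p ∪ ⁅ x ⁆ ∣ ≡ suc ∣ p ∣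
card-insert p {x} x∉p =
  trans (card-∪-disjoint p ⁅ x ⁆ p∩x-empty) (trans (cong (∣ p ∣ +_) (∣⁅x⁆∣≡1 x)) (+-comm ∣ p ∣ 1))
  where
  p∩x-empty : Empty (p ∩ ⁅ x ⁆)
  p∩x-empty (y , y∈) with x∈p∩q⁻ p ⁅ x ⁆ y∈
  ... | y∈p , y∈x rewrite x∈⁅y⁆⇒x≡y x y∈x = x∉p y∈p

card-split : ∀ {n} (p q : Subset n) → ∣ p ∣ ≡ ∣ p ∩ q ∣ + ∣ p ─ q ∣
card-split []            []            = refl
card-split (inside ∷ p)  (inside ∷ q)  = cong suc (card-split p q)
card-split (inside ∷ p)  (outside ∷ q) = trans (cong suc (card-split p q)) (sym (+-suc _ _))
card-split (outside ∷ p) (inside ∷ q)  = card-split p q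
card-split (outside ∷ p) (outside ∷ q) = card-split p q

card-minus : ∀ {n} (p : Subset n) x → x ∈ p → ∣ p ∣ ≡ suc ∣ p - x ∣
card-minus (inside ∷ p)  zero    here       = cong (suc ∘ ∣_∣) (sym (p─⊥≡p p))
card-minus (inside ∷ p)  (suc x) (there x∈) = cong suc (card-minus p x x∈)
card-minus (outside ∷ p) (suc x) (there x∈) = card-minus p x x∈

card-∁ : ∀ {n} (p : Subset n) → ∣ ∁ p ∣ + ∣ p ∣ ≡ n
card-∁ p = trans (cong (_+ ∣ p ∣) (∣∁p∣≡n∸∣p∣ p)) (m∸n+n≡m (∣p∣≤n p))

card-∁-insert : ∀ {n} (p : Subset n) {x} → x ∈ ∁ p → ∣ ∁ p ∣ ≡ suc ∣ ∁ (p ∪ ⁅ x ⁆) ∣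
card-∁-insert {n} p {x} x∈∁p = +-cancelʳ-≡ ∣ p ∣ _ _ (begin
  ∣ ∁ p ∣ + ∣ p ∣                    ≡⟨ card-∁ p ⟩
  n                                  ≡⟨ sym (card-∁ (p ∪ ⁅ x ⁆)) ⟩
  ∣ ∁ (p ∪ ⁅ x ⁆) ∣ + ∣ p ∪ ⁅ x ⁆ ∣  ≡⟨ cong (∣ ∁ (p ∪ ⁅ x ⁆) ∣ +_) (card-insert p (x∈∁p⇒x∉p x∈∁p)) ⟩
  ∣ ∁ (p ∪ ⁅ x ⁆) ∣ + suc ∣ p ∣      ≡⟨ +-suc _ _ ⟩
  suc ∣ ∁ (p ∪ ⁅ x ⁆) ∣ + ∣ p ∣      ∎)
  where open ≡-Reasoning

⊆-card-≡ : ∀ {n} {p q : Subset n} → p ⊆ q → ∣ q ∣ ≤ ∣ p ∣ → q ≡ p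
⊆-card-≡ {p = p} {q} p⊆q ∣q∣≤∣p∣ = ⊆-antisym q⊆p p⊆q
  where
  q⊆p : q ⊆ p
  q⊆p {x} x∈q with x ∈? p
  ... | yes x∈p = x∈p
  ... | no x∉p  = ⊥-elim (<⇒≱ (p⊂q⇒∣p∣<∣q∣ (p⊆q , x , x∈q , x∉p)) ∣q∣≤∣p∣)

subset-of-size : ∀ {n} (S : Subset n) k → k ≤ ∣ S ∣ → ∃ λ W → W ⊆ S × ∣ W ∣ ≡ k
subset-of-size []      zero _ = [] , (λ ()) , refl
subset-of-size {suc n} (s ∷ S) zero _ = ⊥ , ⊥⊆ , ∣⊥∣≡0 (suc n)
subset-of-size (inside ∷ S) (suc k) (s≤s k≤) with subset-of-size S k k≤
... | W , W⊆S , ∣W∣≡k = (inside ∷ W) , in⊆in W⊆S , cong suc ∣W∣≡k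
subset-of-size (outside ∷ S) (suc k) k≤ with subset-of-size S (suc k) k≤
... | W , W⊆S , ∣W∣≡k = (outside ∷ W) , out⊆ W⊆S , ∣W∣≡k

member-of-nonempty : ∀ {n} (S : Subset n) → 0 < ∣ S ∣ → ∃ λ x → x ∈ S
member-of-nonempty {n} S pos with nonempty? S
... | yes ne = ne
... | no e   = ⊥-elim (<⇒≱ pos (≤-reflexive (trans (cong ∣_∣ (Empty-unique e)) (∣⊥∣≡0 n))))

∈─⇒∉ : ∀ {n} (p q : Subset n) {x} → x ∈ p ─ q → x ∉ q
∈─⇒∉ (inside ∷ p) (outside ∷ q) here ()
∈─⇒∉ (s ∷ p) (inside ∷ q)  (there x∈) (there y) = ∈─⇒∉ p q x∈ y
∈─⇒∉ (s ∷ p) (outside ∷ q) (there x∈) (there y) = ∈─⇒∉ p q x∈ y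

∪-⊆ : ∀ {n} {p q s : Subset n} → p ⊆ s → q ⊆ s → p ∪ q ⊆ s
∪-⊆ {p = p} {q} p⊆s q⊆s x∈ with x∈p∪q⁻ p q x∈
... | inj₁ x∈p = p⊆s x∈p
... | inj₂ x∈q = q⊆s x∈q

⁅⁆-⊆ : ∀ {n} {x} {s : Subset n} → x ∈ s → ⁅ x ⁆ ⊆ s
⁅⁆-⊆ {x = x} {s} x∈s y∈ = subst (_∈ s) (sym (x∈⁅y⁆⇒x≡y x y∈)) x∈s

module _ {n : ℕ} (M : Matroid n) where

  augment-to : ∀ {X I} → Indep M X → Indep M I →
    ∃ λ Y → Indep M Y × X ⊆ Y × Y ⊆ X ∪ I × ∣ I ∣ ≤ ∣ Y ∣
  augment-to {X} {I} iX iI = go ∣ I ∣ iX (m≤m+n ∣ I ∣ ∣ X ∣)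
    where
    -- k bounds the number of elements still to be added
    go : ∀ k {X} → Indep M X → ∣ I ∣ ≤ k + ∣ X ∣ →
      ∃ λ Y → Indep M Y × X ⊆ Y × Y ⊆ X ∪ I × ∣ I ∣ ≤ ∣ Y ∣
    go zero {X} iX enough = X , iX , ⊆-refl , p⊆p∪q I , enough
    go (suc k) {X} iX bound with ∣ I ∣ ≤? ∣ X ∣
    ... | yes enough = X , iX , ⊆-refl , p⊆p∪q I , enough
    ... | no short with augment M iX iI (≰⇒> short)
    ... | e , e∈I , e∉X , iXe with go k iXe (subst (∣ I ∣ ≤_) bound′ bound)
      where
      bound′ : suc (k + ∣ X ∣) ≡ k + ∣ X ∪ ⁅ e ⁆ ∣
      bound′ = trans (sym (+-suc k ∣ X ∣)) (cong (k +_) (sym (card-insert X e∉X)))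
    ... | Y , iY , Xe⊆Y , Y⊆XeI , enough =
      Y , iY , Xe⊆Y ∘ p⊆p∪q ⁅ e ⁆ ,
      ⊆-trans Y⊆XeI (∪-⊆ (∪-⊆ (p⊆p∪q I) (⁅⁆-⊆ (q⊆p∪q X I e∈I))) (q⊆p∪q X I)) ,
      enough

  basis-max : ∀ {B X} → Basis M B → Indep M X → ∣ X ∣ ≤ ∣ B ∣
  basis-max {B} {X} (iB , maximal) iX with ∣ X ∣ ≤? ∣ B ∣
  ... | yes le = le
  ... | no gt with augment M iB iX (≰⇒> gt)
  ... | e , _ , e∉B , iBe =
    ⊥-elim (e∉B (subst (e ∈_) (maximal (B ∪ ⁅ e ⁆) (p⊆p∪q ⁅ e ⁆) iBe) (q⊆p∪q B ⁅ e ⁆ (x∈⁅x⁆ e))))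

  basis-of-max-size : ∀ {Y} → Indep M Y → (∀ X → Indep M X → ∣ X ∣ ≤ ∣ Y ∣) → Basis M Y
  basis-of-max-size iY largest = iY , λ X Y⊆X iX → ⊆-card-≡ Y⊆X (largest X iX)

  -- An independent set disjoint from a cocircuit D stays independent when any
  -- element a of D is added: otherwise a basis through it would avoid D.
  cocircuit-extension : ∀ {D I a} → Cocircuit M D → a ∈ D → Indep M I → Empty (I ∩ D) →
    Indep M (I ∪ ⁅ a ⁆)
  cocircuit-extension {D} {I} {a} (D-codependent , D-minimal) a∈D iI I∩D-empty
    with D-minimal (D - a) (x∈p⇒p-x⊂p a∈D)
  ... | B , bB , D-a∩B-empty with augment-to iI (proj₁ bB)
  ... | Y , iY , I⊆Y , Y⊆I∪B , large with a ∈? Y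
  ... | yes a∈Y = indep-⊆ M (∪-⊆ I⊆Y (⁅⁆-⊆ a∈Y)) iY
  ... | no a∉Y  = ⊥-elim (D-codependent (Y , Y-basis , D∩Y-empty))
    where
    Y-basis : Basis M Y
    Y-basis = basis-of-max-size iY (λ X iX → ≤-trans (basis-max bB iX) large)
    D∩Y-empty : Empty (D ∩ Y)
    D∩Y-empty (x , x∈) with x∈p∩q⁻ D Y x∈
    ... | x∈D , x∈Y with x∈p∪q⁻ I B (Y⊆I∪B x∈Y)
    ... | inj₁ x∈I = I∩D-empty (x , x∈p∩q⁺ (x∈I , x∈D))
    ... | inj₂ x∈B with x ≟ a
    ... | yes refl = a∉Y x∈Y
    ... | no x≢a   = D-a∩B-empty (x , x∈p∩q⁺ (x∈p∧x≢y⇒x∈p-y x∈D x≢a , x∈B))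

  circuit-extension : ∀ {C I a} → Circuit M C → a ∈ C → Indep M I →
    ∃ λ Y → Indep M Y × Y ⊆ (C - a) ∪ I × a ∉ Y × ∣ I ∣ ≤ ∣ Y ∣
  circuit-extension {C} {I} {a} (C-dependent , C-minimal) a∈C iI
    with augment-to (C-minimal (C - a) (x∈p⇒p-x⊂p a∈C)) iI
  ... | Y , iY , C-a⊆Y , Y⊆ , large = Y , iY , Y⊆ , a∉Y , large
    where
    a∉Y : a ∉ Y
    a∉Y a∈Y = C-dependent (indep-⊆ M C⊆Y iY)
      where
      C⊆Y : C ⊆ Y
      C⊆Y {x} x∈C with x ≟ a
      ... | yes refl = a∈Y
      ... | no x≢a   = C-a⊆Y (x∈p∧x≢y⇒x∈p-y x∈C x≢a)

  -- r*(M) = |E| - r(M): the complement of a maximum independent set is a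
  -- maximum coindependent set.
  corank-of-rank : ∀ {k m} → HasRank M k → n ≡ k + m → HasCorank M m
  corank-of-rank {k} {m} ((T , iT , ∣T∣≡k) , bounded) n≡k+m =
    (∁ T , (T , T-basis , ∁T∩T-empty) , ∣∁T∣≡m) , coindependent-bound
    where
    T-basis : Basis M T
    T-basis = basis-of-max-size iT (λ X iX → subst (∣ X ∣ ≤_) (sym ∣T∣≡k) (bounded X iX))
    ∁T∩T-empty : Empty (∁ T ∩ T)
    ∁T∩T-empty (x , x∈) with x∈p∩q⁻ (∁ T) T x∈
    ... | x∈∁T , x∈T = x∈∁p⇒x∉p x∈∁T x∈T
    ∣∁T∣≡m : ∣ ∁ T ∣ ≡ m
    ∣∁T∣≡m = +-cancelʳ-≡ k _ _ (begin
      ∣ ∁ T ∣ + k      ≡⟨ cong (∣ ∁ T ∣ +_) (sym ∣T∣≡k) ⟩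
      ∣ ∁ T ∣ + ∣ T ∣  ≡⟨ card-∁ T ⟩
      n                ≡⟨ n≡k+m ⟩
      k + m            ≡⟨ +-comm k m ⟩
      m + k            ∎)
      where open ≡-Reasoning
    coindependent-bound : ∀ X → CoIndep M X → ∣ X ∣ ≤ m
    coindependent-bound X (B , bB , X∩B-empty) = +-cancelʳ-≤ k _ _ (begin
      ∣ X ∣ + k        ≤⟨ +-mono-≤ (p⊆q⇒∣p∣≤∣q∣ X⊆∁B) k≤∣B∣ ⟩
      ∣ ∁ B ∣ + ∣ B ∣  ≡⟨ card-∁ B ⟩
      n                ≡⟨ n≡k+m ⟩
      k + m            ≡⟨ +-comm k m ⟩
      m + k            ∎)
      where
      open ≤-Reasoning
      X⊆∁B : X ⊆ ∁ B
      X⊆∁B x∈X = x∉p⇒x∈∁p (λ x∈B → X∩B-empty (_ , x∈p∩q⁺ (x∈X , x∈B)))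
      k≤∣B∣ : k ≤ ∣ B ∣
      k≤∣B∣ = subst (_≤ ∣ B ∣) ∣T∣≡k (basis-max bB iT)

PairwiseDisjoint : ∀ {n r} → (Fin r → Subset n) → Set
PairwiseDisjoint A = ∀ i j → i ≢ j → Empty (A i ∩ A j)

tail-disjoint : ∀ {n r} {A : Fin (suc r) → Subset n} → PairwiseDisjoint A →
  PairwiseDisjoint (λ j → A (suc j))
tail-disjoint disjoint i j i≢j = disjoint (suc i) (suc j) (i≢j ∘ Fin-suc-injective)

⋃-intro : ∀ {n r} (A : Fin r → Subset n) (J : Subset r) {i x} → i ∈ J → x ∈ A i → x ∈ ⋃[ A ] J
⋃-intro A (inside ∷ J)  here       x∈ = x∈p∪q⁺ (inj₁ x∈)
⋃-intro A (inside ∷ J)  (there i∈) x∈ = x∈p∪q⁺ (inj₂ (⋃-intro (λ j → A (suc j)) J i∈ x∈))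
⋃-intro A (outside ∷ J) (there i∈) x∈ = ⋃-intro (λ j → A (suc j)) J i∈ x∈

⋃-elim : ∀ {n r} (A : Fin r → Subset n) (J : Subset r) {x} → x ∈ ⋃[ A ] J →
  ∃ λ i → i ∈ J × x ∈ A i
⋃-elim {r = zero} A [] x∈ = ⊥-elim (∉⊥ x∈)
⋃-elim {r = suc r} A (inside ∷ J) x∈ with x∈p∪q⁻ (A zero) _ x∈
... | inj₁ x∈A₀ = zero , here , x∈A₀
... | inj₂ x∈⋃ with ⋃-elim (λ j → A (suc j)) J x∈⋃
... | i , i∈ , x∈Ai = suc i , there i∈ , x∈Ai
⋃-elim {r = suc r} A (outside ∷ J) x∈ with ⋃-elim (λ j → A (suc j)) J x∈
... | i , i∈ , x∈Ai = suc i , there i∈ , x∈Ai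

⋃-mono : ∀ {n r} (A : Fin r → Subset n) (J K : Subset r) → J ⊆ K → ⋃[ A ] J ⊆ ⋃[ A ] K
⋃-mono A J K J⊆K x∈ with ⋃-elim A J x∈
... | i , i∈J , x∈Ai = ⋃-intro A K (J⊆K i∈J) x∈Ai

⋃-block : ∀ {n r} (A : Fin r → Subset n) → PairwiseDisjoint A → ∀ J {k x} →
  x ∈ ⋃[ A ] J → x ∈ A k → k ∈ J
⋃-block A disjoint J {k} {x} x∈⋃ x∈Ak with ⋃-elim A J x∈⋃
... | i , i∈J , x∈Ai with i ≟ k
... | yes refl = i∈J
... | no i≢k   = ⊥-elim (disjoint i k i≢k (x , x∈p∩q⁺ (x∈Ai , x∈Ak)))

⋃-remove : ∀ {n r} (A : Fin r → Subset n) J {k x} → x ∈ ⋃[ A ] J → x ∉ A k → x ∈ ⋃[ A ] (J - k)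
⋃-remove A J {k} x∈⋃ x∉Ak with ⋃-elim A J x∈⋃
... | i , i∈J , x∈Ai with i ≟ k
... | yes refl = ⊥-elim (x∉Ak x∈Ai)
... | no i≢k   = ⋃-intro A (J - k) (x∈p∧x≢y⇒x∈p-y i∈J i≢k) x∈Ai

⋃-complement : ∀ {n r} (A : Fin r → Subset n) → ⋃[ A ] ⊤ ≡ ⊤ → ∀ J {x} →
  x ∉ ⋃[ A ] J → x ∈ ⋃[ A ] (∁ J)
⋃-complement A cover J {x} x∉⋃J with ⋃-elim A ⊤ (subst (x ∈_) (sym cover) ∈⊤)
... | i , _ , x∈Ai with i ∈? J
... | yes i∈J = ⊥-elim (x∉⋃J (⋃-intro A J i∈J x∈Ai))
... | no i∉J  = ⋃-intro A (∁ J) (x∉p⇒x∈∁p i∉J) x∈Ai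

⋃-card : ∀ {n r} (A : Fin r → Subset n) → (∀ i → ∣ A i ∣ ≡ 2) → PairwiseDisjoint A →
  ∀ J → ∣ ⋃[ A ] J ∣ ≡ ∣ J ∣ + ∣ J ∣
⋃-card {n} {zero} A _ _ [] = ∣⊥∣≡0 n
⋃-card {r = suc r} A pairs disjoint (inside ∷ J) = begin
  ∣ A zero ∪ ⋃[ A′ ] J ∣      ≡⟨ card-∪-disjoint (A zero) _ head-disjoint ⟩
  ∣ A zero ∣ + ∣ ⋃[ A′ ] J ∣  ≡⟨ cong₂ _+_ (pairs zero) (⋃-card A′ (pairs ∘ suc) (tail-disjoint disjoint) J) ⟩
  2 + (∣ J ∣ + ∣ J ∣)         ≡⟨ cong suc (sym (+-suc ∣ J ∣ ∣ J ∣)) ⟩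
  suc ∣ J ∣ + suc ∣ J ∣       ∎
  where
  open ≡-Reasoning
  A′ : Fin r → Subset _
  A′ j = A (suc j)
  head-disjoint : Empty (A zero ∩ ⋃[ A′ ] J)
  head-disjoint (x , x∈) with x∈p∩q⁻ (A zero) _ x∈
  ... | x∈A₀ , x∈⋃ with ⋃-elim A′ J x∈⋃
  ... | i , _ , x∈Ai = disjoint zero (suc i) (λ ()) (x , x∈p∩q⁺ (x∈A₀ , x∈Ai))
⋃-card {r = suc r} A pairs disjoint (outside ∷ J) =
  ⋃-card (λ j → A (suc j)) (pairs ∘ suc) (tail-disjoint disjoint) J

pair-partition-size : ∀ {n r} {A : Fin r → Subset n} → PairPartition A → n ≡ r + r
pair-partition-size {n} {r} {A} (pairs , disjoint , cover) = begin
  n                      ≡⟨ sym (∣⊤∣≡n n) ⟩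
  ∣ ⊤ {n} ∣              ≡⟨ cong ∣_∣ (sym cover) ⟩
  ∣ ⋃[ A ] ⊤ ∣           ≡⟨ ⋃-card A pairs disjoint ⊤ ⟩
  ∣ ⊤ {r} ∣ + ∣ ⊤ {r} ∣  ≡⟨ cong₂ _+_ (∣⊤∣≡n r) (∣⊤∣≡n r) ⟩
  r + r                  ∎
  where open ≡-Reasoning

module Spike {n t′ r : ℕ} (M : Matroid n) (A : Fin r → Subset n) (t≤r : suc t′ ≤ r)
  (pairs : ∀ i → ∣ A i ∣ ≡ 2) (disjoint : PairwiseDisjoint A) (cover : ⋃[ A ] ⊤ ≡ ⊤)
  (spike : ∀ J → ∣ J ∣ ≡ suc t′ → Circuit M (⋃[ A ] J) × Cocircuit M (⋃[ A ] J)) where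

  block-element : ∀ k → ∃ λ a → a ∈ A k
  block-element k = member-of-nonempty (A k) (subst (0 <_) (sym (pairs k)) (s≤s z≤n))

  t-set-through : ∀ {P : Subset r} {k} → k ∈ P → suc t′ ≤ ∣ P ∣ → ∃ λ K → k ∈ K × K ⊆ P × ∣ K ∣ ≡ suc t′
  t-set-through {P} {k} k∈P many
    with subset-of-size (P - k) t′ (s≤s⁻¹ (subst (suc t′ ≤_) (card-minus P k k∈P) many))
  ... | W , W⊆P-k , ∣W∣≡t′ =
    W ∪ ⁅ k ⁆ , q⊆p∪q W ⁅ k ⁆ (x∈⁅x⁆ k) , ∪-⊆ (p─q⊆p P ⁅ k ⁆ ∘ W⊆P-k) (⁅⁆-⊆ k∈P) ,
    trans (card-insert W k∉W) (cong suc ∣W∣≡t′)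
    where
    k∉W : k ∉ W
    k∉W k∈W = ∈─⇒∉ P ⁅ k ⁆ (W⊆P-k k∈W) (x∈⁅x⁆ k)

  -- Removing one block k from a set P of at least t blocks costs an
  -- independent set inside ⋃P at most one element: exchanging it against the
  -- circuit ⋃K of a t-set K ∋ k leaves at most one element in A k.
  removal-step : ∀ {P : Subset r} {I : Subset n} {k} → k ∈ P → suc t′ ≤ ∣ P ∣ → Indep M I → I ⊆ ⋃[ A ] P →
    ∃ λ I′ → Indep M I′ × I′ ⊆ ⋃[ A ] (P - k) × ∣ I ∣ ≤ suc ∣ I′ ∣
  removal-step {P} {I} {k} k∈P many iI I⊆ with t-set-through k∈P many | block-element k
  ... | K , k∈K , K⊆P , ∣K∣ | a , a∈Ak
    with circuit-extension M (proj₁ (spike K ∣K∣)) (⋃-intro A K k∈K a∈Ak) iI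
  ... | Y , iY , Y⊆ , a∉Y , large =
    Y ─ A k , indep-⊆ M (p─q⊆p Y (A k)) iY , Y─Ak⊆ , ∣I∣≤
    where
    Y⊆⋃P : Y ⊆ ⋃[ A ] P
    Y⊆⋃P = ⊆-trans Y⊆ (∪-⊆ (⋃-mono A K P K⊆P ∘ p─q⊆p _ _) I⊆)
    Y─Ak⊆ : Y ─ A k ⊆ ⋃[ A ] (P - k)
    Y─Ak⊆ x∈ = ⋃-remove A P (Y⊆⋃P (p─q⊆p Y (A k) x∈)) (∈─⇒∉ Y (A k) x∈)
    Y∩Ak⊆ : Y ∩ A k ⊆ A k - a
    Y∩Ak⊆ x∈ with x∈p∩q⁻ Y (A k) x∈
    ... | x∈Y , x∈Ak = x∈p∧x≢y⇒x∈p-y x∈Ak (λ { refl → a∉Y x∈Y })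
    ∣Y∩Ak∣≤1 : ∣ Y ∩ A k ∣ ≤ 1
    ∣Y∩Ak∣≤1 = ≤-trans (p⊆q⇒∣p∣≤∣q∣ Y∩Ak⊆)
      (≤-reflexive (suc-injective (trans (sym (card-minus (A k) a a∈Ak)) (pairs k))))
    ∣I∣≤ : ∣ I ∣ ≤ suc ∣ Y ─ A k ∣
    ∣I∣≤ = ≤-trans large (≤-trans (≤-reflexive (card-split Y (A k))) (+-monoˡ-≤ _ ∣Y∩Ak∣≤1))

  independent-bound : ∀ P {I} → Indep M I → I ⊆ ⋃[ A ] P → ∣ I ∣ ≤ ∣ P ∣ + t′
  independent-bound P = go ∣ P ∣ P refl
    where
    go : ∀ m P {I} → ∣ P ∣ ≡ m → Indep M I → I ⊆ ⋃[ A ] P → ∣ I ∣ ≤ ∣ P ∣ + t′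
    go m P {I} ∣P∣≡m iI I⊆ with ∣ P ∣ ≤? t′ | m
    ... | yes few | _ = begin
      ∣ I ∣          ≤⟨ p⊆q⇒∣p∣≤∣q∣ I⊆ ⟩
      ∣ ⋃[ A ] P ∣   ≡⟨ ⋃-card A pairs disjoint P ⟩
      ∣ P ∣ + ∣ P ∣  ≤⟨ +-monoʳ-≤ ∣ P ∣ few ⟩
      ∣ P ∣ + t′     ∎
      where open ≤-Reasoning
    ... | no many | zero = ⊥-elim (many (subst (_≤ t′) (sym ∣P∣≡m) z≤n))
    ... | no many | suc m′ with member-of-nonempty P (≤-trans (s≤s z≤n) (≰⇒> many))
    ... | k , k∈P with removal-step k∈P (≰⇒> many) iI I⊆
    ... | I′ , iI′ , I′⊆ , ∣I∣≤ = begin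
      ∣ I ∣                  ≤⟨ ∣I∣≤ ⟩
      suc ∣ I′ ∣             ≤⟨ s≤s (go m′ (P - k) ∣P-k∣≡m′ iI′ I′⊆) ⟩
      suc (∣ P - k ∣ + t′)   ≡⟨ cong (_+ t′) (sym (card-minus P k k∈P)) ⟩
      ∣ P ∣ + t′             ∎
      where
      open ≤-Reasoning
      ∣P-k∣≡m′ : ∣ P - k ∣ ≡ m′
      ∣P-k∣≡m′ = suc-injective (trans (sym (card-minus P k k∈P)) ∣P∣≡m)

  -- Adding one block k ∉ U, when at least t blocks lie outside U: an
  -- independent set inside ⋃U avoids the cocircuit ⋃K of a t-set K ∋ k
  -- outside U, so it may absorb an element of A k.
  add-block : ∀ {U : Subset r} {I : Subset n} {k} → k ∈ ∁ U → suc t′ ≤ ∣ ∁ U ∣ → Indep M I → I ⊆ ⋃[ A ] U →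
    ∃ λ I′ → Indep M I′ × I′ ⊆ ⋃[ A ] (U ∪ ⁅ k ⁆) × ∣ I′ ∣ ≡ suc ∣ I ∣
  add-block {U} {I} {k} k∈∁U many iI I⊆ with t-set-through k∈∁U many | block-element k
  ... | K , k∈K , K⊆∁U , ∣K∣ | a , a∈Ak =
    I ∪ ⁅ a ⁆ ,
    cocircuit-extension M (proj₂ (spike K ∣K∣)) (⋃-intro A K k∈K a∈Ak) iI I∩⋃K-empty ,
    ∪-⊆ (⋃-mono A U (U ∪ ⁅ k ⁆) (p⊆p∪q ⁅ k ⁆) ∘ I⊆)
        (⁅⁆-⊆ (⋃-intro A (U ∪ ⁅ k ⁆) (q⊆p∪q U ⁅ k ⁆ (x∈⁅x⁆ k)) a∈Ak)) ,
    card-insert I a∉I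
    where
    outside-U : ∀ {x j} → x ∈ I → x ∈ A j → j ∉ ∁ U
    outside-U x∈I x∈Aj j∈∁U = x∈∁p⇒x∉p j∈∁U (⋃-block A disjoint U (I⊆ x∈I) x∈Aj)
    I∩⋃K-empty : Empty (I ∩ ⋃[ A ] K)
    I∩⋃K-empty (x , x∈) with x∈p∩q⁻ I _ x∈
    ... | x∈I , x∈⋃K with ⋃-elim A K x∈⋃K
    ... | j , j∈K , x∈Aj = outside-U x∈I x∈Aj (K⊆∁U j∈K)
    a∉I : a ∉ I
    a∉I a∈I = outside-U a∈I a∈Ak k∈∁U

  extension : ∀ U {I} → Indep M I → I ⊆ ⋃[ A ] U →
    ∃ λ I′ → Indep M I′ × ∣ I ∣ + ∣ ∁ U ∣ ≤ ∣ I′ ∣ + t′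
  extension U = go ∣ ∁ U ∣ U refl
    where
    go : ∀ m U {I} → ∣ ∁ U ∣ ≡ m → Indep M I → I ⊆ ⋃[ A ] U →
      ∃ λ I′ → Indep M I′ × ∣ I ∣ + ∣ ∁ U ∣ ≤ ∣ I′ ∣ + t′
    go m U {I} ∣∁U∣≡m iI I⊆ with ∣ ∁ U ∣ ≤? t′ | m
    ... | yes few | _ = I , iI , +-monoʳ-≤ ∣ I ∣ few
    ... | no many | zero = ⊥-elim (many (subst (_≤ t′) (sym ∣∁U∣≡m) z≤n))
    ... | no many | suc m′ with member-of-nonempty (∁ U) (≤-trans (s≤s z≤n) (≰⇒> many))
    ... | k , k∈∁U with add-block k∈∁U (≰⇒> many) iI I⊆
    ... | J , iJ , J⊆ , ∣J∣≡
      with go m′ (U ∪ ⁅ k ⁆) (suc-injective (trans (sym (card-∁-insert U k∈∁U)) ∣∁U∣≡m)) iJ J⊆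
    ... | I′ , iI′ , bound = I′ , iI′ , ≤-trans (≤-reflexive exchange) bound
      where
      open ≡-Reasoning
      exchange : ∣ I ∣ + ∣ ∁ U ∣ ≡ ∣ J ∣ + ∣ ∁ (U ∪ ⁅ k ⁆) ∣
      exchange = begin
        ∣ I ∣ + ∣ ∁ U ∣                    ≡⟨ cong (∣ I ∣ +_) (card-∁-insert U k∈∁U) ⟩
        ∣ I ∣ + suc ∣ ∁ (U ∪ ⁅ k ⁆) ∣      ≡⟨ +-suc ∣ I ∣ _ ⟩
        suc ∣ I ∣ + ∣ ∁ (U ∪ ⁅ k ⁆) ∣      ≡⟨ cong (_+ ∣ ∁ (U ∪ ⁅ k ⁆) ∣) (sym ∣J∣≡) ⟩
        ∣ J ∣ + ∣ ∁ (U ∪ ⁅ k ⁆) ∣          ∎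

  t-set : ∃ λ (J : Subset r) → ∣ J ∣ ≡ suc t′
  t-set with subset-of-size (⊤ {r}) (suc t′) (subst (suc t′ ≤_) (sym (∣⊤∣≡n r)) t≤r)
  ... | J , _ , ∣J∣ = J , ∣J∣

  J₀ : Subset r
  J₀ = proj₁ t-set

  ∣J₀∣+∣∁J₀∣ : suc t′ + ∣ ∁ J₀ ∣ ≡ r
  ∣J₀∣+∣∁J₀∣ = trans (cong (_+ ∣ ∁ J₀ ∣) (sym (proj₂ t-set))) (trans (+-comm ∣ J₀ ∣ _) (card-∁ J₀))

  D₀ : Subset n
  D₀ = ⋃[ A ] J₀

  ∣D₀∣ : ∣ D₀ ∣ ≡ suc t′ + suc t′
  ∣D₀∣ = trans (⋃-card A pairs disjoint J₀) (cong₂ _+_ (proj₂ t-set) (proj₂ t-set))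

  D₀-member : ∃ λ a → a ∈ D₀
  D₀-member = member-of-nonempty D₀ (subst (0 <_) (sym ∣D₀∣) (s≤s z≤n))

  a₀ : Fin n
  a₀ = proj₁ D₀-member

  -- Upper bound: a basis B is disjoint from D₀ - a₀, so it has at most one
  -- element in D₀ and at most |∁J₀| + t′ outside it.
  rank-bound : ∀ X → Indep M X → ∣ X ∣ ≤ r
  rank-bound X iX with proj₂ (proj₂ (spike J₀ (proj₂ t-set))) (D₀ - a₀) (x∈p⇒p-x⊂p (proj₂ D₀-member))
  ... | B , bB , D₀-a₀∩B-empty = begin
    ∣ X ∣                       ≤⟨ basis-max M bB iX ⟩
    ∣ B ∣                       ≡⟨ card-split B D₀ ⟩
    ∣ B ∩ D₀ ∣ + ∣ B ─ D₀ ∣     ≤⟨ +-mono-≤ ∣B∩D₀∣≤1 (independent-bound (∁ J₀) iB─D₀ B─D₀⊆) ⟩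
    1 + (∣ ∁ J₀ ∣ + t′)         ≡⟨ cong suc (+-comm ∣ ∁ J₀ ∣ t′) ⟩
    suc t′ + ∣ ∁ J₀ ∣           ≡⟨ ∣J₀∣+∣∁J₀∣ ⟩
    r                           ∎
    where
    open ≤-Reasoning
    B∩D₀⊆ : B ∩ D₀ ⊆ ⁅ a₀ ⁆
    B∩D₀⊆ {x} x∈ with x∈p∩q⁻ B D₀ x∈
    ... | x∈B , x∈D₀ with x ≟ a₀
    ... | yes refl = x∈⁅x⁆ a₀
    ... | no x≢a₀  = ⊥-elim (D₀-a₀∩B-empty (x , x∈p∩q⁺ (x∈p∧x≢y⇒x∈p-y x∈D₀ x≢a₀ , x∈B)))
    ∣B∩D₀∣≤1 : ∣ B ∩ D₀ ∣ ≤ 1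
    ∣B∩D₀∣≤1 = ≤-trans (p⊆q⇒∣p∣≤∣q∣ B∩D₀⊆) (≤-reflexive (∣⁅x⁆∣≡1 a₀))
    iB─D₀ : Indep M (B ─ D₀)
    iB─D₀ = indep-⊆ M (p─q⊆p B D₀) (proj₁ bB)
    B─D₀⊆ : B ─ D₀ ⊆ ⋃[ A ] (∁ J₀)
    B─D₀⊆ x∈ = ⋃-complement A cover J₀ (∈─⇒∉ B D₀ x∈)

  -- Lower bound: D₀ - a₀ is independent of size 2t - 1 inside ⋃J₀, and
  -- extension across the r - t remaining blocks brings it to size r.
  large-independent : ∃ λ T → Indep M T × r ≤ ∣ T ∣
  large-independent with extension J₀ iI₀ (p─q⊆p D₀ ⁅ a₀ ⁆)
    where
    iI₀ : Indep M (D₀ - a₀)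
    iI₀ = proj₂ (proj₁ (spike J₀ (proj₂ t-set))) (D₀ - a₀) (x∈p⇒p-x⊂p (proj₂ D₀-member))
  ... | T , iT , bound = T , iT , +-cancelˡ-≤ t′ _ _ (begin
    t′ + r                          ≡⟨ cong (t′ +_) (sym ∣J₀∣+∣∁J₀∣) ⟩
    t′ + (suc t′ + ∣ ∁ J₀ ∣)        ≡⟨ sym (+-assoc t′ (suc t′) _) ⟩
    t′ + suc t′ + ∣ ∁ J₀ ∣          ≡⟨ cong (_+ ∣ ∁ J₀ ∣) (sym ∣D₀-a₀∣) ⟩
    ∣ D₀ - a₀ ∣ + ∣ ∁ J₀ ∣          ≤⟨ bound ⟩
    ∣ T ∣ + t′                      ≡⟨ +-comm ∣ T ∣ t′ ⟩
    t′ + ∣ T ∣                      ∎)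
    where
    open ≤-Reasoning
    ∣D₀-a₀∣ : ∣ D₀ - a₀ ∣ ≡ t′ + suc t′
    ∣D₀-a₀∣ = suc-injective (trans (sym (card-minus D₀ a₀ (proj₂ D₀-member))) ∣D₀∣)

  rank : HasRank M r
  rank with large-independent
  ... | T , iT , r≤∣T∣ = (T , iT , ≤-antisym (rank-bound T iT) r≤∣T∣) , rank-bound

lemma6p2 : ∀ {n : ℕ} (t r : ℕ) (M : Matroid n) → 1 ≤ t → IsSpike M t r →
    HasRank M r × HasCorank M r
lemma6p2 zero r M () _
lemma6p2 (suc t′) r M _ (A , t≤r , partition@(pairs , disjoint , cover) , spike) =
  rank , corank-of-rank M rank (pair-partition-size partition)
  where open Spike M A t≤r pairs disjoint cover spike
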